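{- Let $n\ge 3$, $p\ge 0$ and $k\ge 2$ be integers and put $\tau=\min\{k-2,p\}$. Then $$C_k(C_n\circledcirc K_p)=\tau\cdot n+C_{k-\tau}(C_n\circledcirc K_{p-\tau}),$$ that is, $$C_k(C_n\circledcirc K_p)=\begin{cases}(k-2)n+C_2(C_n\circledcirc K_{p-(k-2)}) & \text{if } k\le p+2,\\ pn+C_{k-p}(C_n\circledcirc K_0) & \text{if } k>p+2.\end{cases}$$
   Context: Irreversible $k$-threshold process on a finite simple graph $G=(V,E)$: start with a set $S_0\subseteq V$ of colored vertices; for $t\ge1$, $S_t$ consists of $S_{t-1}$ together with every vertex having at least $k$ neighbors in $S_{t-1}$. $S_0$ is an irreversible $k$-threshold conversion set if $S_t=V$ for some $t\ge 0$. $C_k(G)$ is the minimum size of such a set. Double corona product $C_n\circledcirc K_p$: vertices $v_1,\dots,v_n$, $w_1,\dots,w_n$ and $u_i^j$ ($1\le i\le n$, $1\le j\le p$); edges: $v_1\cdots v_n$ forms a cycle, $w_1\cdots w_n$ forms a cycle, each $\{u_i^1,\dots,u_i^p\}$ forms a complete graph $K_p$, and $v_i,w_i$ are each joined to all $u_i^j$; no other edges. $K_0$ is the graph with no vertices, so $C_n\circledcirc K_0$ is two disjoint copies of $C_n$. -}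

module Defs where

open import Data.Nat using (ℕ; zero; suc; _+_; _*_; _∸_; _≤_; _≤ᵇ_; _≡ᵇ_; _⊓_)
open import Data.Bool using (Bool; true; false; _∧_; _∨_; not)
open import Data.Fin using (Fin; zero; suc; toℕ)
open import Data.Fin.Properties using () renaming (_≟_ to _≟F_)
open import Data.List using (List; length; filterᵇ; cartesianProduct; allFin)
open import Data.Product using (Σ; _×_; _,_; ∃)
open import Relation.Nullary.Decidable using (⌊_⌋)
open import Relation.Binary.PropositionalEquality using (_≡_)

-- A finite simple graph, given by a vertex type, a duplicate-free complete
-- enumeration of its vertices and a Boolean adjacency relation.
record FinGraph : Set₁ where
  field
    V        : Set
    vertices : List V
    adj      : V → V → Bool

open FinGraph public

Subset : FinGraph → Set
Subset G = V G → Bool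

card : (G : FinGraph) → Subset G → ℕ
card G S = length (filterᵇ S (vertices G))

nbrCount : (G : FinGraph) → Subset G → V G → ℕ
nbrCount G S v = length (filterᵇ (λ u → adj G v u ∧ S u) (vertices G))

step : (G : FinGraph) → ℕ → Subset G → Subset G
step G k S v = S v ∨ (k ≤ᵇ nbrCount G S v)

iter : (G : FinGraph) → ℕ → Subset G → ℕ → Subset G
iter G k S zero    = S
iter G k S (suc t) = step G k (iter G k S t)

IsConversionSet : (G : FinGraph) → ℕ → Subset G → Set
IsConversionSet G k S = ∃ λ t → ∀ v → iter G k S t v ≡ true

IsCk : (G : FinGraph) → ℕ → ℕ → Set
IsCk G k m =
  (Σ (Subset G) λ S → IsConversionSet G k S × card G S ≡ m)
  × (∀ S → IsConversionSet G k S → m ≤ card G S)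

-- cycle adjacency on Fin n (i ~ i+1 and 0 ~ n-1); a simple cycle for n ≥ 3
cycAdj : (n : ℕ) → Fin n → Fin n → Bool
cycAdj n i j =
  (suc (toℕ i) ≡ᵇ toℕ j) ∨ (suc (toℕ j) ≡ᵇ toℕ i)
  ∨ ((toℕ i ≡ᵇ 0) ∧ (suc (toℕ j) ≡ᵇ n))
  ∨ ((toℕ j ≡ᵇ 0) ∧ (suc (toℕ i) ≡ᵇ n))

eqFin : {n : ℕ} → Fin n → Fin n → Bool
eqFin i j = ⌊ i ≟F j ⌋

-- Vertex (i , tag): tag zero = v_i, tag (suc zero) = w_i,
-- tag (suc (suc j)) = u_i^(j+1).
dcAdj : (n p : ℕ) → Fin n × Fin (2 + p) → Fin n × Fin (2 + p) → Bool
dcAdj n p (i , zero)          (j , zero)          = cycAdj n i j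
dcAdj n p (i , suc zero)      (j , suc zero)      = cycAdj n i j
dcAdj n p (i , zero)          (j , suc zero)      = false
dcAdj n p (i , suc zero)      (j , zero)          = false
dcAdj n p (i , zero)          (j , suc (suc b))   = eqFin i j
dcAdj n p (i , suc zero)      (j , suc (suc b))   = eqFin i j
dcAdj n p (i , suc (suc a))   (j , zero)          = eqFin i j
dcAdj n p (i , suc (suc a))   (j , suc zero)      = eqFin i j
dcAdj n p (i , suc (suc a))   (j , suc (suc b))   = eqFin i j ∧ not (eqFin a b)

DoubleCorona : ℕ → ℕ → FinGraph
DoubleCorona n p = record
  { V        = Fin n × Fin (2 + p)
  ; vertices = cartesianProduct (allFin n) (allFin (2 + p))
  ; adj      = dcAdj n p
  }

{-# OPTIONS --safe #-}

-- Write G = C_n ⊚ K_(τ+p) with threshold τ + k and G' = C_n ⊚ K_p with threshold k ≥ 2.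
-- An uncoloured clique vertex of block i is adjacent only to v_i, w_i and its clique, so if
-- fewer than τ clique vertices of the block are coloured it sees fewer than 2 + τ ≤ τ + k
-- coloured neighbours, and the clique never fills up.  Hence every conversion set of G colours
-- at least τ clique vertices in every block.  Uncolouring exactly τ of them per block yields a
-- set of G' whose process runs in lockstep with the original one: the hubs agree, and every block
-- keeps exactly τ more coloured clique vertices, which is precisely what the τ extra units of
-- threshold absorb, at the hubs as well as in the cliques.  Colouring τ extra clique vertices
-- per block goes the other way, so the two minima differ by τ n.  Minima exist at all because
-- the process stabilises within |V| + 1 steps, which makes conversion decidable.

module Submission where

open import Defs
open import Data.Nat using (ℕ; zero; suc; _+_; _*_; _∸_; _⊓_; _≤_; _<_; _≤ᵇ_; _<ᵇ_; _≤?_; z≤n; s≤s)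
open import Data.Nat.Properties
open import Algebra.Properties.CommutativeMonoid.Sum +-0-commutativeMonoid
  using (sum; sum-cong-≗; sum-replicate-zero; ∑-distrib-+)
open import Algebra.Properties.CommutativeSemigroup +-commutativeSemigroup
  using (x∙yz≈y∙xz)
open import Data.Bool using (Bool; true; false; _∧_; _∨_; not; if_then_else_) renaming (_≟_ to _≟ᵇ_)
open import Data.Bool.Properties using (∨-identityʳ; ∨-zeroʳ; if-float)
open import Data.Fin using (Fin; zero; suc; toℕ)
open import Data.Fin.Properties using () renaming (_≟_ to _≟F_)
open import Data.List using (List; []; _∷_; _++_; length; map; filter; filterᵇ; tabulate; cartesianProduct)
open import Data.List.Extrema.Nat using (argmin; argmin-all; f[argmin]≤f[xs])
open import Data.List.Properties using (length-filter; length-++; filter-++; map-tabulate)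
open import Data.List.Membership.Propositional using (_∈_)
open import Data.List.Membership.Propositional.Properties
  using (∈-++⁺ˡ; ∈-++⁺ʳ; ∈-map⁺; ∈-filter⁺; ∈-cartesianProduct⁺; ∈-allFin)
import Data.List.Relation.Unary.All as All
open import Data.List.Relation.Unary.All.Properties using (all-filter)
open import Data.List.Relation.Unary.Any using (here; there)
open import Data.Sum using (_⊎_; inj₁; inj₂)
open import Data.Product using (Σ; _×_; _,_; ∃)
open import Data.Product.Properties using (≡-dec)
open import Function using (_∘_; id; _⇔_; mk⇔; Equivalence)
open import Relation.Binary.PropositionalEquality
open import Relation.Binary.Definitions using (DecidableEquality)
open import Relation.Nullary using (Dec; does; yes; no; contradiction)
open import Relation.Nullary.Decidable using (T?; map′; does-⇔; dec-false)

bit : Bool → ℕ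
bit false = 0
bit true  = 1

bit≤1 : ∀ b → bit b ≤ 1
bit≤1 false = z≤n
bit≤1 true  = s≤s z≤n

count : ∀ {n} → (Fin n → Bool) → ℕ
count f = sum (bit ∘ f)

sum-const : ∀ n c → sum {n} (λ _ → c) ≡ n * c
sum-const zero    c = refl
sum-const (suc n) c = cong (c +_) (sum-const n c)

eqFin-suc : ∀ {n} (i j : Fin n) → eqFin (suc i) (suc j) ≡ eqFin i j
eqFin-suc i j with i ≟F j
... | yes _ = refl
... | no  _ = refl

sum-select : ∀ {n} (i : Fin n) (g : Bool → Fin n → ℕ) → (∀ j → g false j ≡ 0) →
             sum (λ j → g (eqFin i j) j) ≡ g true i
sum-select {suc n} zero    g g0 = begin
  g true zero + sum (λ j → g false (suc j)) ≡⟨ cong (g true zero +_) (sum-cong-≗ (g0 ∘ suc)) ⟩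
  g true zero + sum {n} (λ _ → 0)          ≡⟨ cong (g true zero +_) (sum-replicate-zero n) ⟩
  g true zero + 0                          ≡⟨ +-identityʳ _ ⟩
  g true zero                              ∎
  where open ≡-Reasoning
sum-select {suc n} (suc i) g g0 = cong₂ _+_ (g0 zero) (begin
  sum (λ j → g (eqFin (suc i) (suc j)) (suc j))
    ≡⟨ sum-cong-≗ (λ j → cong (λ b → g b (suc j)) (eqFin-suc i j)) ⟩
  sum (λ j → g (eqFin i j) (suc j))
    ≡⟨ sum-select i (λ b j → g b (suc j)) (g0 ∘ suc) ⟩
  g true (suc i)
    ∎)
  where open ≡-Reasoning

count≤n : ∀ {n} (f : Fin n → Bool) → count f ≤ n
count≤n {zero}  f = z≤n
count≤n {suc n} f = +-mono-≤ (bit≤1 (f zero)) (count≤n (f ∘ suc))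

count-true : ∀ {n} (f : Fin n → Bool) → (∀ i → f i ≡ true) → count f ≡ n
count-true {zero}  f all = refl
count-true {suc n} f all rewrite all zero = cong suc (count-true (f ∘ suc) (all ∘ suc))

count≡n⇒true : ∀ {n} (f : Fin n → Bool) → count f ≡ n → ∀ i → f i ≡ true
count≡n⇒true {suc n} f eq i with f zero in f0
count≡n⇒true {suc n} f eq zero    | true  = f0
count≡n⇒true {suc n} f eq (suc i) | true  = count≡n⇒true (f ∘ suc) (suc-injective eq) i
count≡n⇒true {suc n} f eq i       | false = contradiction (count≤n (f ∘ suc)) (<⇒≱ (≤-reflexive (sym eq)))

count-remove : ∀ {n} (a : Fin n) (f : Fin n → Bool) →
               count f ≡ bit (f a) + count (λ b → not (eqFin a b) ∧ f b)
count-remove zero    f = refl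
count-remove (suc a) f = begin
  bit (f zero) + count (f ∘ suc)
    ≡⟨ cong (bit (f zero) +_) (count-remove a (f ∘ suc)) ⟩
  bit (f zero) + (bit (f (suc a)) + count (λ b → not (eqFin a b) ∧ f (suc b)))
    ≡⟨ x∙yz≈y∙xz (bit (f zero)) (bit (f (suc a))) _ ⟩
  bit (f (suc a)) + (bit (f zero) + count (λ b → not (eqFin a b) ∧ f (suc b)))
    ≡⟨ cong (λ c → bit (f (suc a)) + (bit (f zero) + c))
            (sum-cong-≗ (λ b → cong (λ e → bit (not e ∧ f (suc b))) (sym (eqFin-suc a b)))) ⟩
  bit (f (suc a)) + (bit (f zero) + count (λ b → not (eqFin (suc a) (suc b)) ∧ f (suc b)))
    ∎
  where open ≡-Reasoning

count-<ᵇ : ∀ {n} m → m ≤ n → count {n} (λ b → toℕ b <ᵇ m) ≡ m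
count-<ᵇ {n}     zero    _         = sum-replicate-zero n
count-<ᵇ {suc n} (suc m) (s≤s m≤n) = cong suc (count-<ᵇ m m≤n)

padTrue : ∀ τ {p} → (Fin p → Bool) → Fin (τ + p) → Bool
padTrue zero    f b       = f b
padTrue (suc τ) f zero    = true
padTrue (suc τ) f (suc b) = padTrue τ f b

count-padTrue : ∀ τ {p} (f : Fin p → Bool) → count (padTrue τ f) ≡ τ + count f
count-padTrue zero    f = refl
count-padTrue (suc τ) f = cong suc (count-padTrue τ f)

count-∨ : ∀ {n} (f : Fin n → Bool) B → count (λ b → f b ∨ B) ≡ (if B then n else count f)
count-∨ f true  = count-true _ (λ b → ∨-zeroʳ (f b))
count-∨ f false = sum-cong-≗ (λ b → cong bit (∨-identityʳ (f b)))

+-cancelˡ-≤ᵇ : ∀ t a b → (t + a ≤ᵇ t + b) ≡ (a ≤ᵇ b)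
+-cancelˡ-≤ᵇ t a b = does-⇔ (mk⇔ (+-cancelˡ-≤ t a b) (+-monoʳ-≤ t)) (t + a ≤? t + b) (a ≤? b)

<⇒≤ᵇ-false : ∀ {a b} → b < a → (a ≤ᵇ b) ≡ false
<⇒≤ᵇ-false {a} {b} b<a = dec-false (a ≤? b) (<⇒≱ b<a)

length-filterᵇ-∷ : ∀ {A : Set} (f : A → Bool) x xs →
                   length (filterᵇ f (x ∷ xs)) ≡ bit (f x) + length (filterᵇ f xs)
length-filterᵇ-∷ f x xs with f x
... | true  = refl
... | false = refl

length-filterᵇ-cong : ∀ {A : Set} {f g : A → Bool} → f ≗ g → ∀ xs →
                      length (filterᵇ f xs) ≡ length (filterᵇ g xs)
length-filterᵇ-cong f≗g []       = refl
length-filterᵇ-cong {f = f} {g} f≗g (x ∷ xs) = begin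
  length (filterᵇ f (x ∷ xs))         ≡⟨ length-filterᵇ-∷ f x xs ⟩
  bit (f x) + length (filterᵇ f xs)   ≡⟨ cong₂ _+_ (cong bit (f≗g x)) (length-filterᵇ-cong f≗g xs) ⟩
  bit (g x) + length (filterᵇ g xs)   ≡⟨ length-filterᵇ-∷ g x xs ⟨
  length (filterᵇ g (x ∷ xs))         ∎
  where open ≡-Reasoning

length-filterᵇ-≤ : ∀ {A : Set} (f : A → Bool) xs → length (filterᵇ f xs) ≤ length xs
length-filterᵇ-≤ f = length-filter (T? ∘ f)

_⊆ᵇ_ : ∀ {A : Set} → (A → Bool) → (A → Bool) → Set
f ⊆ᵇ g = ∀ x → f x ≡ true → g x ≡ true

length-filterᵇ-mono : ∀ {A : Set} {f g : A → Bool} → f ⊆ᵇ g → ∀ xs →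
                      length (filterᵇ f xs) ≤ length (filterᵇ g xs)
length-filterᵇ-mono f⊆g []       = z≤n
length-filterᵇ-mono {f = f} {g} f⊆g (x ∷ xs)
  rewrite length-filterᵇ-∷ f x xs | length-filterᵇ-∷ g x xs =
  +-mono-≤ (bit-mono (f x) (g x) (f⊆g x)) (length-filterᵇ-mono f⊆g xs)
  where
  bit-mono : ∀ a b → (a ≡ true → b ≡ true) → bit a ≤ bit b
  bit-mono false b a⇒b = z≤n
  bit-mono true  b a⇒b rewrite a⇒b refl = ≤-refl

length-filterᵇ-⊆-≡-or-< : ∀ {A : Set} {f g : A → Bool} → f ⊆ᵇ g → ∀ xs →
  (∀ x → x ∈ xs → g x ≡ f x) ⊎ length (filterᵇ f xs) < length (filterᵇ g xs)
length-filterᵇ-⊆-≡-or-< f⊆g [] = inj₁ (λ x ())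
length-filterᵇ-⊆-≡-or-< {f = f} {g} f⊆g (x ∷ xs)
  rewrite length-filterᵇ-∷ f x xs | length-filterᵇ-∷ g x xs
  with f x in fx | g x in gx | length-filterᵇ-⊆-≡-or-< f⊆g xs
... | true  | false | _       = contradiction (trans (sym (f⊆g x fx)) gx) λ ()
... | false | true  | _       = inj₂ (s≤s (length-filterᵇ-mono f⊆g xs))
... | false | false | inj₂ lt = inj₂ lt
... | true  | true  | inj₂ lt = inj₂ (s≤s lt)
... | false | false | inj₁ eq = inj₁ λ { y (here refl) → trans gx (sym fx) ; y (there y∈) → eq y y∈ }
... | true  | true  | inj₁ eq = inj₁ λ { y (here refl) → trans gx (sym fx) ; y (there y∈) → eq y y∈ }

length-filterᵇ-++ : ∀ {A : Set} (f : A → Bool) xs ys →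
                    length (filterᵇ f (xs ++ ys)) ≡ length (filterᵇ f xs) + length (filterᵇ f ys)
length-filterᵇ-++ f xs ys =
  trans (cong length (filter-++ (T? ∘ f) xs ys)) (length-++ (filterᵇ f xs))

length-filterᵇ-tabulate : ∀ {A : Set} {n} (f : A → Bool) (g : Fin n → A) →
                          length (filterᵇ f (tabulate g)) ≡ count (f ∘ g)
length-filterᵇ-tabulate {n = zero}  f g = refl
length-filterᵇ-tabulate {n = suc n} f g =
  trans (length-filterᵇ-∷ f (g zero) _) (cong (bit (f (g zero)) +_) (length-filterᵇ-tabulate f (g ∘ suc)))

length-filterᵇ-cartesianProduct : ∀ {A B : Set} {m n} (f : A × B → Bool) (g : Fin m → A) (h : Fin n → B) →
  length (filterᵇ f (cartesianProduct (tabulate g) (tabulate h))) ≡ sum (λ i → count (λ j → f (g i , h j)))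
length-filterᵇ-cartesianProduct {m = zero}  f g h = refl
length-filterᵇ-cartesianProduct {A} {B} {suc m} f g h = begin
  length (filterᵇ f (row ++ rest))
    ≡⟨ length-filterᵇ-++ f row rest ⟩
  length (filterᵇ f row) + length (filterᵇ f rest)
    ≡⟨ cong (_+ length (filterᵇ f rest)) (cong (length ∘ filterᵇ f) (map-tabulate h (g zero ,_))) ⟩
  length (filterᵇ f (tabulate (λ j → g zero , h j))) + length (filterᵇ f rest)
    ≡⟨ cong₂ _+_ (length-filterᵇ-tabulate f (λ j → g zero , h j)) (length-filterᵇ-cartesianProduct f (g ∘ suc) h) ⟩
  count (λ j → f (g zero , h j)) + sum (λ i → count (λ j → f (g (suc i) , h j)))
    ∎
  where
  open ≡-Reasoning
  row : List (A × B)
  row = map (g zero ,_) (tabulate h)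
  rest : List (A × B)
  rest = cartesianProduct (tabulate (g ∘ suc)) (tabulate h)

module ThresholdProcess (G : FinGraph) (k : ℕ) (complete : ∀ v → v ∈ vertices G) where

  step-cong : ∀ {S S' : Subset G} → S ≗ S' → step G k S ≗ step G k S'
  step-cong {S} {S'} S≗S' v =
    cong₂ (λ b c → b ∨ (k ≤ᵇ c)) (S≗S' v)
          (length-filterᵇ-cong (λ u → cong (adj G v u ∧_) (S≗S' u)) (vertices G))

  iter-cong : ∀ {S S' : Subset G} → S ≗ S' → ∀ t → iter G k S t ≗ iter G k S' t
  iter-cong S≗S' zero    = S≗S'
  iter-cong S≗S' (suc t) = step-cong (iter-cong S≗S' t)

  isConversionSet-cong : ∀ {S S' : Subset G} → S ≗ S' →
                         IsConversionSet G k S → IsConversionSet G k S'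
  isConversionSet-cong S≗S' (t , full) = t , λ v → trans (sym (iter-cong S≗S' t v)) (full v)

  step-inflationary : ∀ S → S ⊆ᵇ step G k S
  step-inflationary S v Sv rewrite Sv = refl

  iter-inflationary : ∀ S t j → iter G k S t ⊆ᵇ iter G k S (j + t)
  iter-inflationary S t zero    v Sv = Sv
  iter-inflationary S t (suc j) v Sv = step-inflationary _ v (iter-inflationary S t j v Sv)

  Fixed : Subset G → Set
  Fixed S = step G k S ≗ S

  iter-fixed : ∀ S s → Fixed (iter G k S s) → ∀ j → iter G k S (j + s) ≗ iter G k S s
  iter-fixed S s fixed zero    = λ _ → refl
  iter-fixed S s fixed (suc j) = λ v → trans (step-cong (iter-fixed S s fixed j) v) (fixed v)

  fixed-or-grows : ∀ S → Fixed S ⊎ card G S < card G (step G k S)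
  fixed-or-grows S with length-filterᵇ-⊆-≡-or-< (step-inflationary S) (vertices G)
  ... | inj₁ eq = inj₁ (λ v → eq v (complete v))
  ... | inj₂ lt = inj₂ lt

  fixed-or-large : ∀ S t → Fixed (iter G k S t) ⊎ t ≤ card G (iter G k S t)
  fixed-or-large S zero = inj₂ z≤n
  fixed-or-large S (suc t) with fixed-or-large S t
  ... | inj₁ fixed = inj₁ (step-cong fixed)
  ... | inj₂ large with fixed-or-grows (iter G k S t)
  ...   | inj₁ fixed = inj₁ (step-cong fixed)
  ...   | inj₂ grows = inj₂ (≤-<-trans large grows)

  |V| : ℕ
  |V| = length (vertices G)

  -- S_{|V|+1} is a fixed point, since it cannot contain |V| + 1 vertices.
  converts-within-|V|+1 : ∀ S → IsConversionSet G k S → ∀ v → iter G k S (suc |V|) v ≡ true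
  converts-within-|V|+1 S (t , full) v with fixed-or-large S (suc |V|)
  ... | inj₂ large = contradiction (≤-trans large (length-filterᵇ-≤ _ (vertices G))) (<⇒≱ ≤-refl)
  ... | inj₁ fixed = begin
    iter G k S (suc |V|) v       ≡⟨ iter-fixed S (suc |V|) fixed t v ⟨
    iter G k S (t + suc |V|) v   ≡⟨ cong (λ s → iter G k S s v) (+-comm t (suc |V|)) ⟩
    iter G k S (suc |V| + t) v   ≡⟨ iter-inflationary S t (suc |V|) v (full v) ⟩
    true                         ∎
    where open ≡-Reasoning

  isConversionSet? : ∀ S → Dec (IsConversionSet G k S)
  isConversionSet? S =
    map′ (λ all → suc |V| , λ v → All.lookup all (complete v))
         (λ conv → All.tabulate λ {v} _ → converts-within-|V|+1 S conv v)
         (All.all? (λ v → iter G k S (suc |V|) v ≟ᵇ true) (vertices G))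

module _ (G : FinGraph) (_≟V_ : DecidableEquality (V G)) (complete : ∀ v → v ∈ vertices G) where

  override : V G → Bool → Subset G → Subset G
  override x b S v = if does (v ≟V x) then b else S v

  subsets : List (V G) → List (Subset G)
  subsets []       = (λ _ → false) ∷ []
  subsets (x ∷ xs) = map (override x true) (subsets xs) ++ map (override x false) (subsets xs)

  override-∈-subsets : ∀ x xs {S} b → S ∈ subsets xs → override x b S ∈ subsets (x ∷ xs)
  override-∈-subsets x xs true  S∈ = ∈-++⁺ˡ (∈-map⁺ (override x true) S∈)
  override-∈-subsets x xs false S∈ =
    ∈-++⁺ʳ (map (override x true) (subsets xs)) (∈-map⁺ (override x false) S∈)

  subsets-complete : ∀ (S : Subset G) xs →
                     Σ (Subset G) λ S' → S' ∈ subsets xs × (∀ v → v ∈ xs → S' v ≡ S v)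
  subsets-complete S []       = _ , here refl , λ v ()
  subsets-complete S (x ∷ xs) with subsets-complete S xs
  ... | S' , S'∈ , agree = override x (S x) S' , override-∈-subsets x xs (S x) S'∈ , agree'
    where
    agree' : ∀ v → v ∈ x ∷ xs → override x (S x) S' v ≡ S v
    agree' v v∈ with v ≟V x
    agree' v v∈           | yes refl = refl
    agree' v (here refl)  | no  v≢x  = contradiction refl v≢x
    agree' v (there v∈xs) | no  v≢x  = agree v v∈xs

  conversionNumber-exists : ∀ k → ∃ λ m → IsCk G k m
  conversionNumber-exists k = card G best , (best , best-converts , refl) , best-minimal
    where
    open ThresholdProcess G k complete
    candidates : List (Subset G)
    candidates = filter isConversionSet? (subsets (vertices G))
    best : Subset G
    best = argmin (card G) (λ _ → true) candidates
    best-converts : IsConversionSet G k best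
    best-converts =
      argmin-all (card G) (0 , λ _ → refl) (all-filter isConversionSet? (subsets (vertices G)))
    best-minimal : ∀ S → IsConversionSet G k S → card G best ≤ card G S
    best-minimal S conv with subsets-complete S (vertices G)
    ... | S' , S'∈ , agree = begin
      card G best ≤⟨ All.lookup (f[argmin]≤f[xs] _ candidates) S'∈candidates ⟩
      card G S'   ≡⟨ length-filterᵇ-cong S'≗S (vertices G) ⟩
      card G S    ∎
      where
      open ≤-Reasoning
      S'≗S : S' ≗ S
      S'≗S v = agree v (complete v)
      S'∈candidates : S' ∈ candidates
      S'∈candidates = ∈-filter⁺ isConversionSet? S'∈ (isConversionSet-cong (sym ∘ S'≗S) conv)

pattern vᵗ   = zero
pattern wᵗ   = suc zero
pattern uᵗ a = suc (suc a)

module _ {n q : ℕ} where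

  cliqueCount : Subset (DoubleCorona n q) → Fin n → ℕ
  cliqueCount S i = count (λ a → S (i , uᵗ a))

  blockCount : Subset (DoubleCorona n q) → Fin n → ℕ
  blockCount S i = count (λ c → S (i , c))

  cycleCount : Subset (DoubleCorona n q) → Fin (2 + q) → Fin n → ℕ
  cycleCount S c i = sum (λ j → bit (cycAdj n i j ∧ S (j , c)))

  card-DoubleCorona : ∀ S → card (DoubleCorona n q) S ≡ sum (blockCount S)
  card-DoubleCorona S = length-filterᵇ-cartesianProduct S id id

  nbrCount-DoubleCorona : ∀ S x → nbrCount (DoubleCorona n q) S x ≡
                          sum (λ j → count (λ c → dcAdj n q x (j , c) ∧ S (j , c)))
  nbrCount-DoubleCorona S x = length-filterᵇ-cartesianProduct (λ y → dcAdj n q x y ∧ S y) id id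

  sum-+-cliqueCount : ∀ S i (f : Fin n → ℕ) →
    sum (λ j → f j + count (λ a → eqFin i j ∧ S (j , uᵗ a))) ≡ sum f + cliqueCount S i
  sum-+-cliqueCount S i f = trans (∑-distrib-+ f _)
    (cong (sum f +_) (sum-select i (λ e j → count (λ a → e ∧ S (j , uᵗ a))) (λ _ → sum-replicate-zero q)))

  nbrCount-v : ∀ S i → nbrCount (DoubleCorona n q) S (i , vᵗ) ≡ cycleCount S vᵗ i + cliqueCount S i
  nbrCount-v S i = trans (nbrCount-DoubleCorona S (i , vᵗ)) (sum-+-cliqueCount S i _)

  nbrCount-w : ∀ S i → nbrCount (DoubleCorona n q) S (i , wᵗ) ≡ cycleCount S wᵗ i + cliqueCount S i
  nbrCount-w S i = trans (nbrCount-DoubleCorona S (i , wᵗ)) (sum-+-cliqueCount S i _)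

  blockCount-u : ∀ S i a →
    blockCount S i ≡ bit (S (i , uᵗ a)) + nbrCount (DoubleCorona n q) S (i , uᵗ a)
  blockCount-u S i a = begin
    bit (S (i , vᵗ)) + (bit (S (i , wᵗ)) + cliqueCount S i)
      ≡⟨ cong (λ c → bit (S (i , vᵗ)) + (bit (S (i , wᵗ)) + c)) (count-remove a (λ b → S (i , uᵗ b))) ⟩
    bit (S (i , vᵗ)) + (bit (S (i , wᵗ)) + (bit (S (i , uᵗ a)) + others i))
      ≡⟨ trans (cong (bit (S (i , vᵗ)) +_) (x∙yz≈y∙xz (bit (S (i , wᵗ))) (bit (S (i , uᵗ a))) (others i)))
               (x∙yz≈y∙xz (bit (S (i , vᵗ))) (bit (S (i , uᵗ a))) _) ⟩
    bit (S (i , uᵗ a)) + (bit (S (i , vᵗ)) + (bit (S (i , wᵗ)) + others i))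
      ≡⟨ cong (bit (S (i , uᵗ a)) +_) (sum-select i row (λ _ → sum-replicate-zero q)) ⟨
    bit (S (i , uᵗ a)) + sum (λ j → row (eqFin i j) j)
      ≡⟨ cong (bit (S (i , uᵗ a)) +_) (nbrCount-DoubleCorona S (i , uᵗ a)) ⟨
    bit (S (i , uᵗ a)) + nbrCount (DoubleCorona n q) S (i , uᵗ a)
      ∎
    where
    open ≡-Reasoning
    others : Fin n → ℕ
    others j = count (λ b → not (eqFin a b) ∧ S (j , uᵗ b))
    row : Bool → Fin n → ℕ
    row e j = bit (e ∧ S (j , vᵗ))
            + (bit (e ∧ S (j , wᵗ)) + count (λ b → (e ∧ not (eqFin a b)) ∧ S (j , uᵗ b)))

  step-u : ∀ K S i a →
    step (DoubleCorona n q) K S (i , uᵗ a) ≡ S (i , uᵗ a) ∨ (K ≤ᵇ blockCount S i)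
  step-u K S i a with S (i , uᵗ a) in Su
  ... | true  = refl
  ... | false = cong (K ≤ᵇ_) (sym (subst (λ b → blockCount S i ≡ bit b + nbrCount G S (i , uᵗ a))
                                        Su (blockCount-u S i a)))
    where
    G : FinGraph
    G = DoubleCorona n q

  cliqueCount-step : ∀ K S i →
    cliqueCount (step (DoubleCorona n q) K S) i ≡ (if K ≤ᵇ blockCount S i then q else cliqueCount S i)
  cliqueCount-step K S i =
    trans (sum-cong-≗ (cong bit ∘ step-u K S i)) (count-∨ (λ a → S (i , uᵗ a)) (K ≤ᵇ blockCount S i))

  blockCount≤2+cliqueCount : ∀ S i → blockCount S i ≤ 2 + cliqueCount S i
  blockCount≤2+cliqueCount S i = +-mono-≤ (bit≤1 (S (i , vᵗ))) (+-mono-≤ (bit≤1 (S (i , wᵗ))) ≤-refl)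

module Reduction (n p τ k : ℕ) where

  G G' : FinGraph
  G  = DoubleCorona n (τ + p)
  G' = DoubleCorona n p

  record _∼_ (S : Subset G) (S' : Subset G') : Set where
    field
      same-v         : ∀ i → S (i , vᵗ) ≡ S' (i , vᵗ)
      same-w         : ∀ i → S (i , wᵗ) ≡ S' (i , wᵗ)
      cliqueCount-+τ : ∀ i → cliqueCount S i ≡ τ + cliqueCount S' i
  open _∼_

  module _ {S : Subset G} {S' : Subset G'} (S∼S' : S ∼ S') where

    blockCount-∼ : ∀ i → blockCount S i ≡ τ + blockCount S' i
    blockCount-∼ i rewrite same-v S∼S' i | same-w S∼S' i | cliqueCount-+τ S∼S' i =
      trans (cong (bit (S' (i , vᵗ)) +_) (x∙yz≈y∙xz (bit (S' (i , wᵗ))) τ _))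
            (x∙yz≈y∙xz (bit (S' (i , vᵗ))) τ _)

    cycleCount-∼ : ∀ {c c'} → (∀ j → S (j , c) ≡ S' (j , c')) →
                   ∀ i → cycleCount S c i ≡ cycleCount S' c' i
    cycleCount-∼ same i = sum-cong-≗ (λ j → cong (λ b → bit (cycAdj n i j ∧ b)) (same j))

    nbrCount-v-∼ : ∀ i → nbrCount G S (i , vᵗ) ≡ τ + nbrCount G' S' (i , vᵗ)
    nbrCount-v-∼ i rewrite nbrCount-v S i | nbrCount-v S' i
                        | cycleCount-∼ (same-v S∼S') i | cliqueCount-+τ S∼S' i =
      x∙yz≈y∙xz (cycleCount S' vᵗ i) τ _

    nbrCount-w-∼ : ∀ i → nbrCount G S (i , wᵗ) ≡ τ + nbrCount G' S' (i , wᵗ)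
    nbrCount-w-∼ i rewrite nbrCount-w S i | nbrCount-w S' i
                        | cycleCount-∼ (same-w S∼S') i | cliqueCount-+τ S∼S' i =
      x∙yz≈y∙xz (cycleCount S' wᵗ i) τ _

    threshold-∼ : ∀ {x y} → x ≡ τ + y → (τ + k ≤ᵇ x) ≡ (k ≤ᵇ y)
    threshold-∼ {y = y} refl = +-cancelˡ-≤ᵇ τ k y

    step-∼ : step G (τ + k) S ∼ step G' k S'
    same-v step-∼ i = cong₂ _∨_ (same-v S∼S' i) (threshold-∼ (nbrCount-v-∼ i))
    same-w step-∼ i = cong₂ _∨_ (same-w S∼S' i) (threshold-∼ (nbrCount-w-∼ i))
    cliqueCount-+τ step-∼ i = begin
      cliqueCount (step G (τ + k) S) i
        ≡⟨ cliqueCount-step (τ + k) S i ⟩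
      (if τ + k ≤ᵇ blockCount S i then τ + p else cliqueCount S i)
        ≡⟨ cong₂ (if_then τ + p else_) (threshold-∼ (blockCount-∼ i)) (cliqueCount-+τ S∼S' i) ⟩
      (if k ≤ᵇ blockCount S' i then τ + p else τ + cliqueCount S' i)
        ≡⟨ if-float (τ +_) (k ≤ᵇ blockCount S' i) ⟨
      τ + (if k ≤ᵇ blockCount S' i then p else cliqueCount S' i)
        ≡⟨ cong (τ +_) (cliqueCount-step k S' i) ⟨
      τ + cliqueCount (step G' k S') i
        ∎
      where open ≡-Reasoning

    all-true-∼ : (∀ x → S x ≡ true) ⇔ (∀ x → S' x ≡ true)
    all-true-∼ = mk⇔ to from
      where
      to : (∀ x → S x ≡ true) → ∀ x → S' x ≡ true
      to all (i , vᵗ)   = trans (sym (same-v S∼S' i)) (all (i , vᵗ))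
      to all (i , wᵗ)   = trans (sym (same-w S∼S' i)) (all (i , wᵗ))
      to all (i , uᵗ a) = count≡n⇒true (λ b → S' (i , uᵗ b))
        (+-cancelˡ-≡ τ _ _ (trans (sym (cliqueCount-+τ S∼S' i)) (count-true _ (λ b → all (i , uᵗ b))))) a
      from : (∀ x → S' x ≡ true) → ∀ x → S x ≡ true
      from all (i , vᵗ)   = trans (same-v S∼S' i) (all (i , vᵗ))
      from all (i , wᵗ)   = trans (same-w S∼S' i) (all (i , wᵗ))
      from all (i , uᵗ a) = count≡n⇒true (λ b → S (i , uᵗ b))
        (trans (cliqueCount-+τ S∼S' i) (cong (τ +_) (count-true _ (λ b → all (i , uᵗ b))))) a

    card-∼ : card G S ≡ τ * n + card G' S'
    card-∼ = begin
      card G S                                 ≡⟨ card-DoubleCorona S ⟩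
      sum (blockCount S)                       ≡⟨ sum-cong-≗ blockCount-∼ ⟩
      sum (λ i → τ + blockCount S' i)          ≡⟨ ∑-distrib-+ (λ _ → τ) (blockCount S') ⟩
      sum {n} (λ _ → τ) + sum (blockCount S')  ≡⟨ cong (_+ sum (blockCount S')) (trans (sum-const n τ) (*-comm n τ)) ⟩
      τ * n + sum (blockCount S')              ≡⟨ cong (τ * n +_) (card-DoubleCorona S') ⟨
      τ * n + card G' S'                       ∎
      where open ≡-Reasoning

  iter-∼ : ∀ {S S'} → S ∼ S' → ∀ t → iter G (τ + k) S t ∼ iter G' k S' t
  iter-∼ S∼S' zero    = S∼S'
  iter-∼ S∼S' (suc t) = step-∼ (iter-∼ S∼S' t)

  isConversionSet-∼ : ∀ {S S'} → S ∼ S' → IsConversionSet G (τ + k) S ⇔ IsConversionSet G' k S'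
  isConversionSet-∼ S∼S' = mk⇔
    (λ (t , full) → t , Equivalence.to   (all-true-∼ (iter-∼ S∼S' t)) full)
    (λ (t , full) → t , Equivalence.from (all-true-∼ (iter-∼ S∼S' t)) full)

  lift : Subset G' → Subset G
  lift S' (i , vᵗ)   = S' (i , vᵗ)
  lift S' (i , wᵗ)   = S' (i , wᵗ)
  lift S' (i , uᵗ a) = padTrue τ (λ b → S' (i , uᵗ b)) a

  lift-∼ : ∀ S' → lift S' ∼ S'
  same-v         (lift-∼ S') i = refl
  same-w         (lift-∼ S') i = refl
  cliqueCount-+τ (lift-∼ S') i = count-padTrue τ (λ b → S' (i , uᵗ b))

  lower : Subset G → Subset G'
  lower S (i , vᵗ)   = S (i , vᵗ)
  lower S (i , wᵗ)   = S (i , wᵗ)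
  lower S (i , uᵗ b) = toℕ b <ᵇ cliqueCount S i ∸ τ

  lower-∼ : ∀ S → (∀ i → τ ≤ cliqueCount S i) → S ∼ lower S
  same-v         (lower-∼ S τ≤) i = refl
  same-w         (lower-∼ S τ≤) i = refl
  cliqueCount-+τ (lower-∼ S τ≤) i = begin
    cliqueCount S i                           ≡⟨ m+[n∸m]≡n (τ≤ i) ⟨
    τ + (cliqueCount S i ∸ τ)                 ≡⟨ cong (τ +_) (count-<ᵇ (cliqueCount S i ∸ τ) excess≤p) ⟨
    τ + cliqueCount (lower S) i               ∎
    where
    open ≡-Reasoning
    excess≤p : cliqueCount S i ∸ τ ≤ p
    excess≤p = subst (cliqueCount S i ∸ τ ≤_) (m+n∸m≡n τ p)
                     (∸-monoˡ-≤ τ (count≤n (λ a → S (i , uᵗ a))))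

  blockCount<τ+k : 2 ≤ k → ∀ (S : Subset G) i → cliqueCount S i < τ → blockCount S i < τ + k
  blockCount<τ+k k≥2 S i small = begin-strict
    blockCount S i      ≤⟨ blockCount≤2+cliqueCount S i ⟩
    2 + cliqueCount S i <⟨ +-monoʳ-< 2 small ⟩
    2 + τ               ≡⟨ +-comm 2 τ ⟩
    τ + 2               ≤⟨ +-monoʳ-≤ τ k≥2 ⟩
    τ + k               ∎
    where open ≤-Reasoning

  cliqueCount-step-small : 2 ≤ k → ∀ (S : Subset G) i → cliqueCount S i < τ →
                           cliqueCount (step G (τ + k) S) i ≡ cliqueCount S i
  cliqueCount-step-small k≥2 S i small =
    trans (cliqueCount-step (τ + k) S i)
          (cong (if_then τ + p else cliqueCount S i) (<⇒≤ᵇ-false (blockCount<τ+k k≥2 S i small)))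

  cliqueCount-iter-small : 2 ≤ k → ∀ (S : Subset G) i → cliqueCount S i < τ →
                           ∀ t → cliqueCount (iter G (τ + k) S t) i ≡ cliqueCount S i
  cliqueCount-iter-small k≥2 S i small zero    = refl
  cliqueCount-iter-small k≥2 S i small (suc t) =
    trans (cliqueCount-step-small k≥2 _ i (subst (_< τ) (sym IH) small)) IH
    where
    IH : cliqueCount (iter G (τ + k) S t) i ≡ cliqueCount S i
    IH = cliqueCount-iter-small k≥2 S i small t

  isConversionSet⇒τ≤cliqueCount : 2 ≤ k → ∀ (S : Subset G) → IsConversionSet G (τ + k) S →
                                  ∀ i → τ ≤ cliqueCount S i
  isConversionSet⇒τ≤cliqueCount k≥2 S (t , full) i =
    ≮⇒≥ λ small → m+n≮m τ p (subst (_< τ) (full-cliqueCount small) small)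
    where
    full-cliqueCount : cliqueCount S i < τ → cliqueCount S i ≡ τ + p
    full-cliqueCount small = trans (sym (cliqueCount-iter-small k≥2 S i small t))
                                   (count-true _ (λ a → full (i , uᵗ a)))

  IsCk-shift : 2 ≤ k → ∀ m → IsCk G' k m → IsCk G (τ + k) (τ * n + m)
  IsCk-shift k≥2 m ((S' , converts' , card≡m) , minimal') =
    (lift S' , Equivalence.from (isConversionSet-∼ (lift-∼ S')) converts' , card-lift) , minimal
    where
    card-lift : card G (lift S') ≡ τ * n + m
    card-lift = trans (card-∼ (lift-∼ S')) (cong (τ * n +_) card≡m)
    minimal : ∀ S → IsConversionSet G (τ + k) S → τ * n + m ≤ card G S
    minimal S converts = begin
      τ * n + m                  ≤⟨ +-monoʳ-≤ (τ * n) (minimal' (lower S) lower-converts) ⟩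
      τ * n + card G' (lower S)  ≡⟨ card-∼ S∼ ⟨
      card G S                   ∎
      where
      open ≤-Reasoning
      S∼ : S ∼ lower S
      S∼ = lower-∼ S (isConversionSet⇒τ≤cliqueCount k≥2 S converts)
      lower-converts : IsConversionSet G' k (lower S)
      lower-converts = Equivalence.to (isConversionSet-∼ S∼) converts

DoubleCorona-complete : ∀ {n q} (x : V (DoubleCorona n q)) → x ∈ vertices (DoubleCorona n q)
DoubleCorona-complete (i , c) = ∈-cartesianProduct⁺ (∈-allFin i) (∈-allFin c)

_≟DC_ : ∀ {n q} → DecidableEquality (V (DoubleCorona n q))
_≟DC_ = ≡-dec _≟F_ _≟F_

-- Nothing in the argument depends on the cycles.
mainTheorem7 : (n p k : ℕ) → 3 ≤ n → 2 ≤ k →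
    let τ = (k ∸ 2) ⊓ p in
    (∃ λ m → IsCk (DoubleCorona n (p ∸ τ)) (k ∸ τ) m)
    × (∀ m → IsCk (DoubleCorona n (p ∸ τ)) (k ∸ τ) m →
             IsCk (DoubleCorona n p) k (τ * n + m))
mainTheorem7 n p k _ k≥2 =
  conversionNumber-exists (DoubleCorona n (p ∸ τ)) _≟DC_ DoubleCorona-complete (k ∸ τ) ,
  λ m Ck → subst₂ (λ q K → IsCk (DoubleCorona n q) K (τ * n + m))
                  (m+[n∸m]≡n τ≤p) (m+[n∸m]≡n τ≤k)
                  (Reduction.IsCk-shift n (p ∸ τ) τ (k ∸ τ) 2≤k∸τ m Ck)
  where
  τ : ℕ
  τ = (k ∸ 2) ⊓ p
  τ≤p : τ ≤ p
  τ≤p = m⊓n≤n (k ∸ 2) p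
  τ≤k∸2 : τ ≤ k ∸ 2
  τ≤k∸2 = m⊓n≤m (k ∸ 2) p
  τ≤k : τ ≤ k
  τ≤k = ≤-trans τ≤k∸2 (m∸n≤m k 2)
  2≤k∸τ : 2 ≤ k ∸ τ
  2≤k∸τ = subst (_≤ k ∸ τ) (m∸[m∸n]≡n k≥2) (∸-monoʳ-≤ k τ≤k∸2)
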